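{- Fix $k\ge 4$, let $G$ be a graph, let $\mathcal{P}$ be the collection returned by Approx1 on $G$, and let $\mathcal{Q}$ be an optimal solution of the Max-$k$ path cover problem on $G$. For any vertex $u_j$ on a path $P\in\mathcal{P}$ with $j\le k-2$, if $n(u_j)\le k-j-2$, then $u_j$ receives at most $\frac32\min\{j,k-j-2\}+1$ vertices.
   Context: The order of a path is its number of vertices. The Max-$k$ path cover problem: given $G$, find a collection of vertex-disjoint paths each of order at least $k$ covering the maximum number of vertices; $\mathcal{Q}$ is any such optimal collection. $V(\mathcal{P})$, $E(\mathcal{P})$ denote unions of vertex/edge sets. Vertex naming on a path $P$ of order $\ell$: choose an endpoint; $u_j$ is the vertex at distance $j$ from it ($0\le j\le\lceil\ell/2\rceil-1$), $v_j$ the vertex at distance $j$ from the other endpoint ($0\le j\le\lfloor\ell/2\rfloor-1$). For $v\in V(\mathcal{P})$, an extension $e(v)$ is a path in $G[V\setminus V(\mathcal{P})]$ with an endpoint adjacent to $v$ (the empty path of order 0 is allowed); $n(v)$ is the maximum order of an extension at $v$. Operations: (Add) if $G[V\setminus V(\mathcal{P})]$ has a $k$-path, add it. (Rep) if for $P\in\mathcal{P}$ there are $t$ and $e(u_t)$ with $n(e(u_t))\ge t+1$, replace the prefix $u_0$-$\cdots$-$u_{t-1}$ by $e(u_t)$ (symmetrically for $v_t$). (DoubleRep) for $P\in\mathcal{P}$: (i) if there are $t$, $j\ge t+1$ and vertex-disjoint $e(u_t),e(u_j)$ with $n(e(u_t))\ge k-t-1$, $n(e(u_j))\ge k-(n(P)-j)$,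 replace $P$ by $u_0$-$\cdots$-$u_t$-$e(u_t)$ and $e(u_j)$-$u_j$-$\cdots$-$v_0$; (ii) if there are $t,j$ and vertex-disjoint $e(u_t),e(v_j)$ with $n(e(u_t))\ge k-t-1$, $n(e(v_j))\ge k-j-1$, replace $P$ by $u_0$-$\cdots$-$u_t$-$e(u_t)$ and $e(v_j)$-$v_j$-$\cdots$-$v_0$. Algorithm Approx1: start with $\mathcal{P}=\emptyset$; while one of Add, Rep, DoubleRep is applicable, apply it and then break every path of order at least $2k$ into two paths one of which is a $k$-path; return $\mathcal{P}$ when none applies. Amortization: $\mathcal{Q}-\mathcal{P}$ is the collection of sub-paths of paths of $\mathcal{Q}$ obtained by deleting $V(\mathcal{P})$. A path $S$ of $\mathcal{Q}-\mathcal{P}$ is associated with $v\in V(\mathcal{P})\cap V(\mathcal{Q})$ if an endpoint of $S$ is adjacent to $v$ via an edge of $E(\mathcal{Q})$. Vertices of $V(\mathcal{Q})$ are assigned as follows: each vertex of $V(\mathcal{Q})\cap V(\mathcal{P})$ is assigned to itself; for each path $S$ of $\mathcal{Q}-\mathcal{P}$ associated with exactly one vertex $v$, all $n(S)$ vertices of $S$ are assigned to $v$; if $S$ is associated with two vertices $v_1,v_2$, then $n(S)/2$ vertices are assigned to each. The number of vertices a vertex receives is the (possibly fractional) total assigned to it (0 if it is not in $V(\mathcal{Q})$). -}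

module Defs where

open import Data.Nat using (ℕ; zero; suc; _+_; _*_; _∸_; _≤_; _<_; ⌈_/2⌉; ⌊_/2⌋)
open import Data.Fin using (Fin)
import Data.Fin as F
open import Data.Bool using (Bool; true; false; if_then_else_; _∨_; _∧_)
open import Data.Maybe using (Maybe; just; nothing)
open import Data.List using (List; []; _∷_; _++_; length; concat; reverse; take; drop; map)
open import Data.Nat.ListAction using (sum)
open import Data.List.Relation.Unary.All using (All)
open import Data.List.Relation.Unary.Linked using (Linked)
open import Data.List.Relation.Unary.Unique.Propositional using (Unique)
open import Data.List.Relation.Binary.Permutation.Propositional using (_↭_)
open import Data.List.Membership.Propositional using (_∈_; _∉_)
open import Data.Product using (Σ; _×_; _,_)
open import Data.Sum using (_⊎_)
open import Relation.Nullary using (¬_; does)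
open import Relation.Binary.PropositionalEquality using (_≡_)
open import Relation.Binary.Construct.Closure.ReflexiveTransitive using (Star)

record Graph (n : ℕ) : Set₁ where
  field
    Adj    : Fin n → Fin n → Set
    sym    : ∀ {x y} → Adj x y → Adj y x
    irrefl : ∀ {x} → ¬ Adj x x

module _ {n : ℕ} (G : Graph n) where
  open Graph G
  open import Data.List.Membership.DecPropositional (F._≟_ {n}) using (_∈?_)

  V : Set
  V = Fin n

  -- a path is a list of distinct vertices, consecutive ones adjacent;
  -- its order is its length (the empty list is the path of order 0)
  IsPath : List V → Set
  IsPath p = Unique p × Linked Adj p

  Coll : Set
  Coll = List (List V)

  -- vertex-disjoint collection of paths; V(𝒞) = concat 𝒞
  IsPathColl : Coll → Set
  IsPathColl 𝒞 = All IsPath 𝒞 × Unique (concat 𝒞)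

  Disjoint : List V → List V → Set
  Disjoint e f = All (λ x → x ∉ f) e

  -- e is an extension at v w.r.t. 𝒫: a path in G[V ∖ V(𝒫)], empty or with
  -- an endpoint (stored as its head) adjacent to v
  Ext : Coll → V → List V → Set
  Ext 𝒫 v e = IsPath e × Disjoint e (concat 𝒫)
            × (e ≡ [] ⊎ Σ V λ w → Σ (List V) λ es → e ≡ w ∷ es × Adj v w)

  -- the two possible namings of a path (choice of the endpoint u₀)
  Orient : List V → List V → Set
  Orient p q = q ≡ p ⊎ q ≡ reverse p

  -- u is the vertex at position t (distance t from the head) of q
  At : List V → ℕ → V → Set
  At q t u = Σ (List V) λ r → drop t q ≡ u ∷ r

  module _ (k : ℕ) where

    data Op (𝒫 : Coll) : Coll → Set where
      add : ∀ p → IsPath p → length p ≡ k → Disjoint p (concat 𝒫) → Op 𝒫 (p ∷ 𝒫)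
      rep : ∀ {p rest q} t u e → 𝒫 ↭ p ∷ rest → Orient p q
          → t < ⌈ length q /2⌉ → At q t u
          → Ext 𝒫 u e → t + 1 ≤ length e
          → Op 𝒫 ((reverse e ++ drop t q) ∷ rest)
      doubleRepI : ∀ {p rest q} t j u w et ej → 𝒫 ↭ p ∷ rest → Orient p q
          → t < j → j < ⌈ length q /2⌉ → At q t u → At q j w
          → Ext 𝒫 u et → Ext 𝒫 w ej → Disjoint et ej
          → k ∸ t ∸ 1 ≤ length et → k ∸ (length q ∸ j) ≤ length ej
          → Op 𝒫 ((take (suc t) q ++ et) ∷ (reverse ej ++ drop j q) ∷ rest)
      doubleRepII : ∀ {p rest q} t j u w et ej → 𝒫 ↭ p ∷ rest → Orient p q
          → t < ⌈ length q /2⌉ → j < ⌊ length q /2⌋ → At q t u → At (reverse q) j w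
          → Ext 𝒫 u et → Ext 𝒫 w ej → Disjoint et ej
          → k ∸ t ∸ 1 ≤ length et → k ∸ j ∸ 1 ≤ length ej
          → Op 𝒫 ((take (suc t) q ++ et) ∷ (take (suc j) (reverse q) ++ ej) ∷ rest)

    data BreakStep (𝒫 : Coll) : Coll → Set where
      brk : ∀ {p rest q} → 𝒫 ↭ p ∷ rest → Orient p q → 2 * k ≤ length q
          → BreakStep 𝒫 (take k q ∷ drop k q ∷ rest)

    Round : Coll → Coll → Set
    Round 𝒫 𝒫″ = Σ Coll λ 𝒫′ → Op 𝒫 𝒫′ × Star BreakStep 𝒫′ 𝒫″
                 × All (λ p → length p < 2 * k) 𝒫″

    Approx1Output : Coll → Set
    Approx1Output 𝒫 = Star Round [] 𝒫 × (∀ 𝒫′ → ¬ Op 𝒫 𝒫′)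

    KCover : Coll → Set
    KCover 𝒬 = IsPathColl 𝒬 × All (λ q → k ≤ length q) 𝒬

    Optimal : Coll → Set
    Optimal 𝒬 = KCover 𝒬 × (∀ ℛ → KCover ℛ → length (concat ℛ) ≤ length (concat 𝒬))

  -- A segment (a , S , b) is a path S of 𝒬 − 𝒫 (a maximal run of
  -- a path of 𝒬 avoiding V(𝒫)) with a / b the vertex of V(𝒫) preceding /
  -- following S on that 𝒬-path (if any): these are its associated vertices.
  Seg : Set
  Seg = Maybe V × List V × Maybe V

  close : Maybe V → List V → Maybe V → List Seg
  close a []       b = []
  close a (x ∷ xs) b = (a , x ∷ xs , b) ∷ []

  segs : Coll → Maybe V → List V → List V → List Seg
  segs 𝒫 a run []       = close a run nothing
  segs 𝒫 a run (x ∷ xs) with does (x ∈? concat 𝒫)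
  ... | true  = close a run (just x) ++ segs 𝒫 (just x) [] xs
  ... | false = segs 𝒫 a (run ++ x ∷ []) xs

  isJust : Maybe V → Bool
  isJust (just _) = true
  isJust nothing  = false

  is : V → Maybe V → Bool
  is x (just y) = does (x F.≟ y)
  is x nothing  = false

  -- twice the number of vertices of segment s assigned to x
  contrib2 : V → Seg → ℕ
  contrib2 x (a , S , b) =
    if is x a ∨ is x b
    then (if isJust a ∧ isJust b then length S else 2 * length S)
    else 0

  -- twice the (possibly half-integral) number of vertices x receives
  received2 : Coll → Coll → V → ℕ
  received2 𝒫 𝒬 x =
    (if does (x ∈? concat 𝒬) ∧ does (x ∈? concat 𝒫) then 2 else 0)
    + sum (map (λ q → sum (map (contrib2 x) (segs 𝒫 nothing [] q))) 𝒬)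

{-# OPTIONS --safe #-}
module Submission where

-- Only the path Q of 𝒬 through u can give u anything besides u itself, and
-- only through the two runs of 𝒬 − 𝒫 adjacent to u on Q.  The run after u, and
-- the reversed run before u, are extensions at u, so each has order at most
-- k − j − 2 by hypothesis and at most j because Rep does not apply at u.
-- A run shared with a second vertex of 𝒫 gives u half of itself, a run
-- reaching an end of Q gives all of itself; both runs cannot reach the ends of
-- Q, since then Q would have fewer than j + 1 + (k − j − 2) + 1 = k vertices.

open import Defs
open import Data.Nat using (ℕ; zero; suc; _+_; _*_; _∸_; _≤_; _<_; ⌈_/2⌉; _⊓_; z≤n; s≤s)
open import Data.Nat.Properties
open import Data.Nat.ListAction using (sum)
open import Data.Nat.ListAction.Properties using (sum-++)
open import Data.List using (List; []; _∷_; _++_; [_]; _∷ʳ_; _ʳ++_; length; concat; reverse; map; take; head)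
import Data.List.Properties as List
open import Data.List.Membership.Propositional using (_∈_; _∉_)
open import Data.List.Membership.Propositional.Properties using (∈-∃++; ∈-concat⁺′; ∈-++⁺ˡ; ∈-++⁺ʳ)
open import Data.List.Relation.Unary.Any using (here; there)
open import Data.List.Relation.Unary.Any.Properties using (reverse⁻)
open import Data.List.Relation.Unary.All as All using (All; []; _∷_)
import Data.List.Relation.Unary.All.Properties as All
open import Data.List.Relation.Unary.Linked as Linked using (Linked; []; [-]; _∷_; _∷′_)
open import Data.List.Relation.Unary.AllPairs using ([]; _∷_)
open import Data.List.Relation.Unary.Unique.Propositional using (Unique)
open import Data.List.Relation.Unary.Unique.Propositional.Properties using (Unique[x∷xs]⇒x∉xs)
open import Data.List.Relation.Binary.Permutation.Propositional using (↭-sym; ↭⇒↭ₛ)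
open import Data.List.Relation.Binary.Permutation.Propositional.Properties using (shift; ↭-reverse; All-resp-↭)
import Data.List.Relation.Binary.Permutation.Setoid.Properties as Permutationₛ
open import Data.Maybe using (Maybe; just; nothing)
import Data.Maybe.Relation.Binary.Connected as Connected
import Data.Fin as Fin
open import Data.Bool using (true; false; _∨_; _∧_; if_then_else_)
open import Data.Product using (Σ; _×_; _,_; proj₁; proj₂)
open import Data.Sum using (inj₁; inj₂)
open import Data.Empty using (⊥; ⊥-elim)
open import Relation.Nullary using (¬_; yes; no)
open import Relation.Binary.Definitions using (Symmetric)
open import Relation.Binary.PropositionalEquality
  using (_≡_; _≢_; refl; sym; trans; cong; cong₂; subst; setoid; module ≡-Reasoning)

module _ {A : Set} where

  Unique-++⁻ʳ : ∀ (xs : List A) {ys} → Unique (xs ++ ys) → Unique ys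
  Unique-++⁻ʳ []       uniq       = uniq
  Unique-++⁻ʳ (x ∷ xs) (_ ∷ uniq) = Unique-++⁻ʳ xs uniq

  Unique-++⁻ˡ : ∀ (xs : List A) {ys} → Unique (xs ++ ys) → Unique xs
  Unique-++⁻ˡ []       _           = []
  Unique-++⁻ˡ (x ∷ xs) (x∉ ∷ uniq) = All.++⁻ˡ xs x∉ ∷ Unique-++⁻ˡ xs uniq

  Unique-++-disjoint : ∀ (xs : List A) {ys x} → Unique (xs ++ ys) → x ∈ xs → x ∉ ys
  Unique-++-disjoint (y ∷ xs) (y≢ ∷ _)   (here refl)  x∈ys = All.lookup (All.++⁻ʳ xs y≢) x∈ys refl
  Unique-++-disjoint (y ∷ xs) (_ ∷ uniq) (there x∈xs) x∈ys = Unique-++-disjoint xs uniq x∈xs x∈ys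

  Unique-reverse : ∀ {xs : List A} → Unique xs → Unique (reverse xs)
  Unique-reverse {xs} = Permutationₛ.Unique-resp-↭ (setoid A) (↭⇒↭ₛ (↭-sym (↭-reverse xs)))

  module _ {R : A → A → Set} where

    Linked-++⁻ʳ : ∀ (xs : List A) {ys} → Linked R (xs ++ ys) → Linked R ys
    Linked-++⁻ʳ []       linked = linked
    Linked-++⁻ʳ (x ∷ xs) linked = Linked-++⁻ʳ xs (Linked.tail linked)

    Linked-++⁻ˡ : ∀ (xs : List A) {ys} → Linked R (xs ++ ys) → Linked R xs
    Linked-++⁻ˡ []           _            = []
    Linked-++⁻ˡ (x ∷ [])     _            = [-]
    Linked-++⁻ˡ (x ∷ y ∷ xs) (r ∷ linked) = r ∷ Linked-++⁻ˡ (y ∷ xs) linked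

    module _ (R-sym : Symmetric R) where

      Linked-ʳ++ : ∀ {xs ys : List A} → Linked R xs → Connected.Connected R (head xs) (head ys) →
                   Linked R ys → Linked R (xs ʳ++ ys)
      Linked-ʳ++ {[]}     _      _ lys = lys
      Linked-ʳ++ {x ∷ xs} lxs conn lys =
        Linked-ʳ++ (Linked.tail lxs) (Connected.sym R-sym (Linked.head′ lxs)) (conn ∷′ lys)

      Linked-reverse : ∀ {xs : List A} → Linked R xs → Linked R (reverse xs)
      Linked-reverse {[]}    _      = []
      Linked-reverse {_ ∷ _} linked =
        Linked-ʳ++ (Linked.tail linked) (Connected.sym R-sym (Linked.head′ linked)) [-]

module _ {n : ℕ} (G : Graph n) where

  IsPath-++⁻ˡ : ∀ (xs : List (V G)) {ys} → IsPath G (xs ++ ys) → IsPath G xs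
  IsPath-++⁻ˡ xs (uniq , linked) = Unique-++⁻ˡ xs uniq , Linked-++⁻ˡ xs linked

  IsPath-++⁻ʳ : ∀ (xs : List (V G)) {ys} → IsPath G (xs ++ ys) → IsPath G ys
  IsPath-++⁻ʳ xs (uniq , linked) = Unique-++⁻ʳ xs uniq , Linked-++⁻ʳ xs linked

  IsPath-reverse : ∀ {xs} → IsPath G xs → IsPath G (reverse xs)
  IsPath-reverse (uniq , linked) = Unique-reverse uniq , Linked-reverse (Graph.sym G) linked

  At-∈ : ∀ {q t u} → At G q t u → u ∈ q
  At-∈ {q} {t} {u} (_ , drop≡) =
    subst (u ∈_) (List.take++drop≡id t q) (∈-++⁺ʳ (take t q) (subst (u ∈_) (sym drop≡) (here refl)))

  Orient-∈ : ∀ {p q x} → Orient G p q → x ∈ q → x ∈ p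
  Orient-∈ (inj₁ refl) x∈q = x∈q
  Orient-∈ (inj₂ refl) x∈q = reverse⁻ x∈q

ext≤-of-¬Rep : ∀ {n} {G : Graph n} {k 𝒫 p q j u e} → (∀ 𝒫′ → ¬ Op G k 𝒫 𝒫′) →
               p ∈ 𝒫 → Orient G p q → j < ⌈ length q /2⌉ → At G q j u → Ext G 𝒫 u e → length e ≤ j
ext≤-of-¬Rep {p = p} {j = j} {u} {e} noOp p∈𝒫 orient j<⌈q/2⌉ at ext
  with xs , ys , refl ← ∈-∃++ p∈𝒫 =
  ≮⇒≥ λ j<|e| → noOp _ (rep j u e (shift p xs ys) orient j<⌈q/2⌉ at ext (subst (_≤ length e) (+-comm 1 j) j<|e|))

1+a+b<k : ∀ {k j a b} → 2 ≤ k → j ≤ k ∸ 2 → a ≤ j → b ≤ k ∸ j ∸ 2 → suc (a + b) < k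
1+a+b<k {suc zero}    (s≤s ()) _ _ _
1+a+b<k {suc (suc k)} {j} {a} {b} _ j≤k a≤j b≤k∸j∸2 = s≤s (s≤s (begin
  a + b       ≤⟨ +-mono-≤ a≤j (subst (b ≤_) k∸j∸2≡ b≤k∸j∸2) ⟩
  j + (k ∸ j) ≡⟨ m+[n∸m]≡n j≤k ⟩
  k           ∎))
  where
    open ≤-Reasoning
    k∸j∸2≡ : suc (suc k) ∸ j ∸ 2 ≡ k ∸ j
    k∸j∸2≡ = trans (∸-+-assoc (suc (suc k)) j 2) (cong (suc (suc k) ∸_) (+-comm j 2))

module Assignment {n : ℕ} (G : Graph n) (𝒫 : Coll G) (u : V G) where
  open import Data.List.Membership.DecPropositional (Fin._≟_ {n}) using (_∈?_)

  Outside : V G → Set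
  Outside x = x ∉ concat 𝒫

  extension : ∀ {e} → IsPath G (u ∷ e) → All Outside e → Ext G 𝒫 u e
  extension {[]}    _                         _   = ([] , []) , [] , inj₁ refl
  extension {w ∷ e} (_ ∷ uniq , adj ∷ linked) out = (uniq , linked) , out , inj₂ (w , e , refl , adj)

  share : Seg G → ℕ
  share = contrib2 G u

  shares : List (Seg G) → ℕ
  shares ss = sum (map share ss)

  shares-++ : ∀ ss ts → shares (ss ++ ts) ≡ shares ss + shares ts
  shares-++ ss ts = trans (cong sum (List.map-++ share ss ts)) (sum-++ (map share ss) (map share ts))

  share-[] : ∀ a b → share (a , [] , b) ≡ 0
  share-[] a b with is G u a ∨ is G u b | isJust G a ∧ isJust G b
  ... | true  | true  = refl
  ... | true  | false = refl
  ... | false | _     = refl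

  shares-close : ∀ a S b → shares (close G a S b) ≡ share (a , S , b)
  shares-close a []      b = sym (share-[] a b)
  shares-close a (_ ∷ _) b = +-identityʳ _

  is-≢ : ∀ {x} → u ≢ x → is G u (just x) ≡ false
  is-≢ {x} u≢x with u Fin.≟ x
  ... | yes u≡x = ⊥-elim (u≢x u≡x)
  ... | no _    = refl

  share-unassociated : ∀ a S b → is G u a ≡ false → is G u b ≡ false → share (a , S , b) ≡ 0
  share-unassociated a S b ia ib rewrite ia | ib = refl

  share≤2*length : ∀ a S b → share (a , S , b) ≤ 2 * length S
  share≤2*length a S b with is G u a ∨ is G u b | isJust G a ∧ isJust G b
  ... | true  | true  = m≤m+n (length S) _
  ... | true  | false = ≤-refl
  ... | false | _     = z≤n

  share-between≤length : ∀ x S y → share (just x , S , just y) ≤ length S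
  share-between≤length x S y with is G u (just x) ∨ is G u (just y)
  ... | true  = ≤-refl
  ... | false = z≤n

  share-pair≤ : ∀ {m} a S x T b → length S ≤ m → length T ≤ m → (a ≡ nothing → b ≡ nothing → ⊥) →
                share (a , S , just x) + share (just x , T , b) ≤ 3 * m
  share-pair≤ {m} (just y) S x T (just z) S≤m T≤m _ =
    ≤-trans (+-mono-≤ (≤-trans (share-between≤length y S x) S≤m) (≤-trans (share-between≤length x T z) T≤m))
            (+-monoʳ-≤ m (m≤m+n m _))
  share-pair≤ {m} nothing S x T (just z) S≤m T≤m _ =
    ≤-trans (+-mono-≤ (≤-trans (share≤2*length nothing S (just x)) (*-monoʳ-≤ 2 S≤m))
                      (≤-trans (share-between≤length x T z) T≤m))
            (≤-reflexive (+-comm (2 * m) m))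
  share-pair≤ {m} (just y) S x T nothing S≤m T≤m _ =
    +-mono-≤ (≤-trans (share-between≤length y S x) S≤m)
             (≤-trans (share≤2*length (just x) T nothing) (*-monoʳ-≤ 2 T≤m))
  share-pair≤ nothing S x T nothing _ _ notBoth = ⊥-elim (notBoth refl refl)

  shares-avoiding : ∀ {a} acc xs → is G u a ≡ false → u ∉ xs → shares (segs G 𝒫 a acc xs) ≡ 0
  shares-avoiding {a} acc [] ia _ = trans (shares-close a acc nothing) (share-unassociated a acc nothing ia refl)
  shares-avoiding {a} acc (x ∷ xs) ia u∉ with x ∈? concat 𝒫
  ... | yes _ = begin
    shares (close G a acc (just x) ++ segs G 𝒫 (just x) [] xs)      ≡⟨ shares-++ (close G a acc (just x)) _ ⟩
    shares (close G a acc (just x)) + shares (segs G 𝒫 (just x) [] xs)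
      ≡⟨ cong₂ _+_ (trans (shares-close a acc (just x)) (share-unassociated a acc (just x) ia ix))
                   (shares-avoiding [] xs ix (λ u∈xs → u∉ (there u∈xs))) ⟩
    0                                                               ∎
    where
      open ≡-Reasoning
      ix = is-≢ (λ u≡x → u∉ (here u≡x))
  ... | no _ = shares-avoiding (acc ++ [ x ]) xs ia (λ u∈xs → u∉ (there u∈xs))

  sharesIn : List (V G) → ℕ
  sharesIn q = shares (segs G 𝒫 nothing [] q)

  sharesIn-avoiding : ∀ 𝒬 → u ∉ concat 𝒬 → sum (map sharesIn 𝒬) ≡ 0
  sharesIn-avoiding []      _  = refl
  sharesIn-avoiding (q ∷ 𝒬) u∉ =
    cong₂ _+_ (shares-avoiding [] q refl (λ u∈q → u∉ (∈-++⁺ˡ u∈q)))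
              (sharesIn-avoiding 𝒬 (λ u∈𝒬 → u∉ (∈-++⁺ʳ q u∈𝒬)))

  -- run is the stretch of xs outside V(𝒫) next to u, i.e. a path of 𝒬 − 𝒫, and
  -- anchor its other associated vertex; anchor is nothing only when run reaches
  -- an end of the 𝒬-path (in RunBefore a xs, a is the anchor in force before xs).
  record RunBefore (a : Maybe (V G)) (xs : List (V G)) : Set where
    field
      anchor     : Maybe (V G)
      prefix run : List (V G)
      split      : xs ≡ prefix ++ run
      outside    : All Outside run
      unanchored : anchor ≡ nothing → a ≡ nothing × prefix ≡ []

  record RunAfter (xs : List (V G)) : Set where
    field
      anchor     : Maybe (V G)
      run suffix : List (V G)
      split      : xs ≡ run ++ suffix
      outside    : All Outside run
      unanchored : anchor ≡ nothing → suffix ≡ []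

  RunBefore-cast : ∀ {a xs ys} → xs ≡ ys → RunBefore a xs → RunBefore a ys
  RunBefore-cast xs≡ys r = record { RunBefore r ; split = trans (sym xs≡ys) (RunBefore.split r) }

  RunAfter-cast : ∀ {xs ys} → xs ≡ ys → RunAfter xs → RunAfter ys
  RunAfter-cast xs≡ys r = record { RunAfter r ; split = trans (sym xs≡ys) (RunAfter.split r) }

  shares-after : ∀ acc zs → u ∉ zs → All Outside acc →
                 Σ (RunAfter (acc ++ zs)) λ r →
                   shares (segs G 𝒫 (just u) acc zs) ≡ share (just u , RunAfter.run r , RunAfter.anchor r)
  shares-after acc [] _ out =
    record { anchor = nothing ; run = acc ; suffix = [] ; split = refl ; outside = out ; unanchored = λ _ → refl } ,
    shares-close (just u) acc nothing
  shares-after acc (z ∷ zs) u∉ out with z ∈? concat 𝒫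
  ... | yes _ =
    record { anchor = just z ; run = acc ; suffix = z ∷ zs ; split = refl ; outside = out ; unanchored = λ () } ,
    (begin
      shares (close G (just u) acc (just z) ++ segs G 𝒫 (just z) [] zs)   ≡⟨ shares-++ (close G (just u) acc (just z)) _ ⟩
      shares (close G (just u) acc (just z)) + shares (segs G 𝒫 (just z) [] zs)
        ≡⟨ cong₂ _+_ (shares-close (just u) acc (just z))
                     (shares-avoiding [] zs (is-≢ (λ u≡z → u∉ (here u≡z))) (λ u∈zs → u∉ (there u∈zs))) ⟩
      share (just u , acc , just z) + 0                                  ≡⟨ +-identityʳ _ ⟩
      share (just u , acc , just z)                                      ∎)
    where open ≡-Reasoning
  ... | no z∉𝒫 =
    let r , eq = shares-after (acc ++ [ z ]) zs (λ u∈zs → u∉ (there u∈zs)) (All.++⁺ out (z∉𝒫 ∷ []))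
    in RunAfter-cast (List.∷ʳ-++ acc z zs) r , eq

  module _ (u∈𝒫 : u ∈ concat 𝒫) where

    shares-before : ∀ {a} acc ys zs → is G u a ≡ false → u ∉ ys → All Outside acc →
                    Σ (RunBefore a (acc ++ ys)) λ r →
                      shares (segs G 𝒫 a acc (ys ++ u ∷ zs))
                        ≡ share (RunBefore.anchor r , RunBefore.run r , just u) + shares (segs G 𝒫 (just u) [] zs)
    shares-before {a} acc [] zs _ _ out with u ∈? concat 𝒫
    ... | no u∉𝒫 = ⊥-elim (u∉𝒫 u∈𝒫)
    ... | yes _ =
      record { anchor = a ; prefix = [] ; run = acc ; split = List.++-identityʳ acc ; outside = out
             ; unanchored = λ a≡nothing → a≡nothing , refl } ,
      trans (shares-++ (close G a acc (just u)) _) (cong (_+ _) (shares-close a acc (just u)))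
    shares-before {a} acc (y ∷ ys) zs ia u∉ out with y ∈? concat 𝒫
    ... | yes _ =
      let r , eq = shares-before [] ys zs iy (λ u∈ys → u∉ (there u∈ys)) []
          open RunBefore r
      in record { anchor = anchor ; prefix = acc ++ y ∷ prefix ; run = run
                ; split = trans (cong (λ ws → acc ++ y ∷ ws) split) (sym (List.++-assoc acc (y ∷ prefix) run))
                ; outside = outside ; unanchored = λ a≡nothing → ⊥-elim (just≢nothing (proj₁ (unanchored a≡nothing))) } ,
         (begin
           shares (close G a acc (just y) ++ segs G 𝒫 (just y) [] (ys ++ u ∷ zs))
             ≡⟨ shares-++ (close G a acc (just y)) _ ⟩
           shares (close G a acc (just y)) + shares (segs G 𝒫 (just y) [] (ys ++ u ∷ zs))
             ≡⟨ cong₂ _+_ (trans (shares-close a acc (just y)) (share-unassociated a acc (just y) ia iy)) eq ⟩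
           share (anchor , run , just u) + shares (segs G 𝒫 (just u) [] zs) ∎)
      where
        open ≡-Reasoning
        iy = is-≢ (λ u≡y → u∉ (here u≡y))
        just≢nothing : ∀ {x : V G} → just x ≢ nothing
        just≢nothing ()
    ... | no y∉𝒫 =
      let r , eq = shares-before (acc ++ [ y ]) ys zs ia (λ u∈ys → u∉ (there u∈ys)) (All.++⁺ out (y∉𝒫 ∷ []))
      in RunBefore-cast (List.∷ʳ-++ acc y ys) r , eq

    module _ {k m : ℕ} (ext≤m : ∀ e → Ext G 𝒫 u e → length e ≤ m)
             (ext+ext<k : ∀ e f → Ext G 𝒫 u e → Ext G 𝒫 u f → suc (length e + length f) < k) where

      sharesIn-path≤ : ∀ q → IsPath G q → k ≤ length q → u ∈ q → sharesIn q ≤ 3 * m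
      sharesIn-path≤ q path k≤|q| u∈q with ys , zs , refl ← ∈-∃++ u∈q = begin
        sharesIn (ys ++ u ∷ zs)                                     ≡⟨ proj₂ before ⟩
        share (left , S , just u) + shares (segs G 𝒫 (just u) [] zs) ≡⟨ cong (share (left , S , just u) +_) (proj₂ after) ⟩
        share (left , S , just u) + share (just u , T , right)       ≤⟨ share-pair≤ left S u T right (S≤m) (T≤m) notBoth ⟩
        3 * m                                                       ∎
        where
          open ≤-Reasoning
          u∉ys : u ∉ ys
          u∉ys u∈ys = Unique-++-disjoint ys (proj₁ path) u∈ys (here refl)
          before = shares-before [] ys zs refl u∉ys []
          after  = shares-after [] zs (Unique[x∷xs]⇒x∉xs (Unique-++⁻ʳ ys (proj₁ path))) []
          open RunBefore (proj₁ before) using (prefix)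
            renaming (anchor to left; run to S; split to ys≡; outside to S-outside; unanchored to left-unanchored)
          open RunAfter (proj₁ after) using ()
            renaming (anchor to right; run to T; split to zs≡; outside to T-outside; unanchored to right-unanchored)

          path-S-u : IsPath G (S ∷ʳ u)
          path-S-u = IsPath-++⁻ˡ G (S ∷ʳ u) (IsPath-++⁻ʳ G prefix (subst (IsPath G) q≡ path))
            where
              q≡ : ys ++ u ∷ zs ≡ prefix ++ (S ∷ʳ u) ++ zs
              q≡ = trans (cong (_++ u ∷ zs) ys≡)
                         (trans (List.++-assoc prefix S (u ∷ zs)) (cong (prefix ++_) (sym (List.∷ʳ-++ S u zs))))

          ext-S : Ext G 𝒫 u (reverse S)
          ext-S = extension (subst (IsPath G) (List.reverse-++ S [ u ]) (IsPath-reverse G path-S-u))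
                            (All-resp-↭ (↭-sym (↭-reverse S)) S-outside)

          ext-T : Ext G 𝒫 u T
          ext-T = extension (IsPath-++⁻ˡ G (u ∷ T) (subst (IsPath G) (cong (u ∷_) zs≡) (IsPath-++⁻ʳ G ys path)))
                            T-outside

          S≤m : length S ≤ m
          S≤m = subst (_≤ m) (List.length-reverse S) (ext≤m _ ext-S)

          T≤m : length T ≤ m
          T≤m = ext≤m T ext-T

          notBoth : left ≡ nothing → right ≡ nothing → ⊥
          notBoth left≡nothing right≡nothing = <⇒≱ (ext+ext<k (reverse S) T ext-S ext-T) (subst (k ≤_) |q|≡ k≤|q|)
            where
              |ys|≡ : length ys ≡ length S
              |ys|≡ = cong length (trans ys≡ (cong (_++ S) (proj₂ (left-unanchored left≡nothing))))
              |zs|≡ : length zs ≡ length T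
              |zs|≡ = cong length (trans zs≡ (trans (cong (T ++_) (right-unanchored right≡nothing)) (List.++-identityʳ T)))
              |q|≡ : length (ys ++ u ∷ zs) ≡ suc (length (reverse S) + length T)
              |q|≡ = trans (List.length-++ ys)
                           (trans (cong₂ (λ s t → s + suc t) |ys|≡ |zs|≡)
                                  (trans (+-suc (length S) (length T))
                                         (cong (λ s → suc (s + length T)) (sym (List.length-reverse S)))))

      sharesIn-cover≤ : ∀ 𝒬 → KCover G k 𝒬 → sum (map sharesIn 𝒬) ≤ 3 * m
      sharesIn-cover≤ []      _ = z≤n
      sharesIn-cover≤ (q ∷ 𝒬) ((path ∷ paths , uniq) , k≤|q| ∷ long) with u ∈? q
      ... | yes u∈q = begin
        sharesIn q + sum (map sharesIn 𝒬) ≡⟨ cong (sharesIn q +_) (sharesIn-avoiding 𝒬 (Unique-++-disjoint q uniq u∈q)) ⟩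
        sharesIn q + 0                    ≡⟨ +-identityʳ _ ⟩
        sharesIn q                        ≤⟨ sharesIn-path≤ q path k≤|q| u∈q ⟩
        3 * m                             ∎
        where open ≤-Reasoning
      ... | no u∉q = begin
        sharesIn q + sum (map sharesIn 𝒬) ≡⟨ cong (_+ sum (map sharesIn 𝒬)) (shares-avoiding [] q refl u∉q) ⟩
        sum (map sharesIn 𝒬)              ≤⟨ sharesIn-cover≤ 𝒬 ((paths , Unique-++⁻ʳ q uniq) , long) ⟩
        3 * m                             ∎
        where open ≤-Reasoning

lemma6 : (k : ℕ) → 4 ≤ k → {n : ℕ} (G : Graph n)
       → (𝒫 : Coll G) → Approx1Output G k 𝒫
       → (𝒬 : Coll G) → Optimal G k 𝒬
       → (p : List (V G)) → p ∈ 𝒫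
       → (q : List (V G)) → Orient G p q
       → (j : ℕ) → j < ⌈ length q /2⌉ → (u : V G) → At G q j u
       → j ≤ k ∸ 2
       → (∀ e → Ext G 𝒫 u e → length e ≤ k ∸ j ∸ 2)
       → received2 G 𝒫 𝒬 u ≤ 3 * (j ⊓ (k ∸ j ∸ 2)) + 2
lemma6 k 4≤k G 𝒫 (_ , noOp) 𝒬 (cover , _) p p∈𝒫 q orient j j<⌈q/2⌉ u at j≤k∸2 ext≤k∸j∸2 =
  ≤-trans (+-mono-≤ (self≤2 _) (sharesIn-cover≤ u∈𝒫 ext≤m ext+ext<k 𝒬 cover)) (≤-reflexive (+-comm 2 _))
  where
    open Assignment G 𝒫 u
    u∈𝒫 : u ∈ concat 𝒫
    u∈𝒫 = ∈-concat⁺′ (Orient-∈ G orient (At-∈ G {t = j} at)) p∈𝒫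
    ext≤j : ∀ e → Ext G 𝒫 u e → length e ≤ j
    ext≤j e = ext≤-of-¬Rep noOp p∈𝒫 orient j<⌈q/2⌉ at
    ext≤m : ∀ e → Ext G 𝒫 u e → length e ≤ j ⊓ (k ∸ j ∸ 2)
    ext≤m e ext = ⊓-glb (ext≤j e ext) (ext≤k∸j∸2 e ext)
    ext+ext<k : ∀ e f → Ext G 𝒫 u e → Ext G 𝒫 u f → suc (length e + length f) < k
    ext+ext<k e f ext ext′ = 1+a+b<k (≤-trans (s≤s (s≤s z≤n)) 4≤k) j≤k∸2 (ext≤j e ext) (ext≤k∸j∸2 f ext′)
    self≤2 : ∀ b → (if b then 2 else 0) ≤ 2
    self≤2 true  = ≤-refl
    self≤2 false = z≤n
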